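{- Let $n=2k+1$ be odd with $k\ge1$, let $a\in\mathbb{F}_{2^n}$ be nonzero, and let $g$ be a permutation of $\mathbb{F}_{2^n}$. Then the function $x\mapsto g(x)+a^{ -1}\mathrm{Tr}(a^3g(x)^3)$ is a 2-to-1 function on $\mathbb{F}_{2^n}$, and its image is a $(2^{2k},2,2^{2k},2^{2k-1})$ relative difference set in $(\mathbb{F}_{2^n},+)$ relative to the subgroup $N=\{0,a^{ -1}\}$.
   Context: $\mathrm{Tr}$ denotes the absolute trace from $\mathbb{F}_{2^n}$ to $\mathbb{F}_2$. A function $F:\mathbb{F}_{2^n}\to\mathbb{F}_{2^n}$ is 2-to-1 if every element of its image has exactly two preimages. Let $G$ be a finite group of order $mn'$ with a normal subgroup $N$ of order $n'$. A $k'$-subset $R\subseteq G$ is an $(m,n',k',\lambda)$ relative difference set relative to $N$ if the list of differences $r-r'$ with $r,r'\in R$, $r\ne r'$, covers every element of $G\setminus N$ exactly $\lambda$ times and covers no element of $N\setminus\{0\}$. -}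

module Defs where

open import Level using (0ℓ)
open import Data.Nat as ℕ using (ℕ; zero; suc)
open import Data.List using (List; length; filter; cartesianProduct)
open import Data.List.Membership.Propositional using (_∈_)
open import Data.List.Relation.Unary.Unique.Propositional using (Unique)
open import Data.Product using (_×_; _,_; ∃)
open import Relation.Binary.PropositionalEquality using (_≡_; refl)
open import Relation.Binary.Definitions using (DecidableEquality)
open import Relation.Nullary using (¬_; _×-dec_; ¬?)
open import Relation.Unary using (Pred; Decidable)
open import Algebra.Structures using (IsCommutativeRing)
open import Data.List.Relation.Unary.Any using (Any; any?; here; there)
open import Data.List.Membership.Propositional using (find)
open import Relation.Nullary using (yes; no; Dec)

record FiniteField2^ (n : ℕ) : Set₁ where
  infixl 6 _+_
  infixl 7 _*_
  field
    Carrier : Set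
    _+_ _*_ : Carrier → Carrier → Carrier
    -_      : Carrier → Carrier
    0# 1#   : Carrier
    isCommutativeRing : IsCommutativeRing _≡_ _+_ _*_ -_ 0# 1#
    0≢1     : ¬ (0# ≡ 1#)
    _⁻¹     : Carrier → Carrier
    ⁻¹-inverse : ∀ x → ¬ (x ≡ 0#) → x * (x ⁻¹) ≡ 1#
    _≟_     : DecidableEquality Carrier
    elements : List Carrier
    complete : ∀ x → x ∈ elements
    unique   : Unique elements
    card     : length elements ≡ 2 ℕ.^ n

  _^_ : Carrier → ℕ → Carrier
  x ^ zero  = 1#
  x ^ suc m = x * (x ^ m)

  -- absolute trace Tr(x) = Σ_{i<n} x^(2^i), with values in the prime field {0,1} ⊆ F
  traceSum : ℕ → Carrier → Carrier
  traceSum zero    x = 0#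
  traceSum (suc i) x = (x ^ (2 ℕ.^ i)) + traceSum i x

  Tr : Carrier → Carrier
  Tr = traceSum n

  countF : {P : Pred Carrier 0ℓ} → Decidable P → ℕ
  countF P? = length (filter P? elements)

  preimages : (Carrier → Carrier) → Carrier → ℕ
  preimages f y = countF (λ x → f x ≟ y)

  IsTwoToOne : (Carrier → Carrier) → Set
  IsTwoToOne f = ∀ y → (∃ λ x → f x ≡ y) → preimages f y ≡ 2

  image? : (f : Carrier → Carrier) → Decidable (λ y → ∃ λ x → f x ≡ y)
  image? f y with any? (λ x → f x ≟ y) elements
  ... | yes p = yes (let (x , _ , e) = find p in x , e)
  ... | no ¬p = no (λ { (x , e) → ¬p (anyOf x e (complete x)) })
    where
    anyOf : ∀ {xs} x → f x ≡ y → x ∈ xs → Any (λ z → f z ≡ y) xs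
    anyOf x e (here refl) = here e
    anyOf x e (there m)   = there (anyOf x e m)

  IsPermutation : (Carrier → Carrier) → Set
  IsPermutation g = (∀ x y → g x ≡ g y → x ≡ y) × (∀ y → ∃ λ x → g x ≡ y)

  diffCount : {R : Pred Carrier 0ℓ} → Decidable R → Carrier → ℕ
  diffCount R? d =
    length (filter (λ { (r , r') → R? r ×-dec R? r' ×-dec ¬? (r ≟ r') ×-dec ((r + (- r')) ≟ d) })
                   (cartesianProduct elements elements))

  IsAddSubgroup : {N : Pred Carrier 0ℓ} → Decidable N → Set
  IsAddSubgroup {N} _ = N 0# × (∀ x y → N x → N y → N (x + y)) × (∀ x → N x → N (- x))

  IsRelDiffSet : (m n' k' λ' : ℕ) {N R : Pred Carrier 0ℓ} → Decidable N → Decidable R → Set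
  IsRelDiffSet m n' k' λ' {N} {R} N? R? =
      (2 ℕ.^ n ≡ m ℕ.* n')
    × IsAddSubgroup N?
    × (countF N? ≡ n')
    × (countF R? ≡ k')
    × (∀ d → ¬ N d → diffCount R? d ≡ λ')
    × (∀ d → N d → ¬ (d ≡ 0#) → diffCount R? d ≡ 0)

-- Put b = a⁻¹ and h y = Tr (a³ y³), so that f = φ ∘ g with φ u = u + b · h u.  Expanding
-- (y + d)³ shows h (y + d) = h y + Tr (y · D d) + h d for an explicit D, with D b = 0; as n is
-- odd, Tr 1 = 1 and hence h (y + b) = h y + 1.  So φ identifies u with u + b and maps onto
-- {h = 0}, which translation by b shows is half of the field.  For d ∉ {0, b} we get D d ≠ 0,
-- because cubing is injective when 3 ∤ 2ⁿ - 1; translating by a w with Tr (w · D d) = 1 then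
-- swaps {r | h r = h (r + d)} with its complement, and translating by b splits that set evenly
-- between h r = h (r + d) = 0 and = 1, which gives the 2^(2k-1) differences.

module Submission where

open import Level using (0ℓ)
open import Data.Nat as ℕ using (ℕ; zero; suc; _≥_)
import Data.Nat.Properties as ℕₚ
open import Data.Nat.Tactic.RingSolver using (solve-∀)
open import Data.List using (List; []; _∷_; length; filter; map; foldr; _++_; cartesianProduct)
open import Data.List.Properties using (length-++; length-map; filter-all; filter-none)
open import Data.List.Membership.Propositional using (_∈_)
open import Data.List.Membership.Propositional.Properties
  using (∈-cartesianProduct⁺; ∈-filter⁺; ∈-filter⁻; ∈-map⁺; ∈-map⁻; ∈-++⁺ˡ; ∈-++⁺ʳ; ∈-++⁻)
open import Data.List.Membership.Propositional.Properties.WithK using (unique∧set⇒bag)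
open import Data.List.Relation.Binary.BagAndSetEquality using (∼bag⇒↭)
open import Data.List.Relation.Binary.Permutation.Propositional using (_↭_; ↭⇒↭ₛ)
open import Data.List.Relation.Binary.Permutation.Setoid.Properties using (foldr-commMonoid)
open import Data.List.Relation.Binary.Permutation.Propositional.Properties using (↭-length)
open import Data.List.Relation.Unary.All using ([]; _∷_; universal)
open import Data.List.Relation.Unary.AllPairs using ([]; _∷_)
open import Data.List.Relation.Unary.Any using (here; there)
open import Data.List.Relation.Unary.Unique.Propositional using (Unique)
import Data.List.Relation.Unary.Unique.Propositional.Properties as Unique
open import Data.Product using (_×_; _,_; ∃; proj₁; proj₂)
import Data.Product as Product
open import Data.Sum using (_⊎_; inj₁; inj₂)
import Data.Sum as Sum
open import Function using (_∘_; id)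
open import Function.Bundles using (mk⇔)
open import Relation.Binary.PropositionalEquality
open import Relation.Nullary using (¬_; yes; no; _⊎-dec_; _×-dec_)
open import Data.Empty using (⊥; ⊥-elim)
open import Relation.Unary using (Pred; Decidable)
open import Relation.Unary.Properties using (∁?; _∪?_)

open import Algebra.Bundles using (CommutativeRing)
open import Algebra.Structures using (IsCommutativeRing)
open import Data.Maybe using (nothing)
open import Tactic.RingSolver.Core.AlmostCommutativeRing using (fromCommutativeRing)

open import Defs

unique-set⇒↭ : {A : Set} {xs ys : List A} → Unique xs → Unique ys →
               (∀ {z} → z ∈ xs → z ∈ ys) → (∀ {z} → z ∈ ys → z ∈ xs) → xs ↭ ys
unique-set⇒↭ xs! ys! to from = ∼bag⇒↭ (unique∧set⇒bag xs! ys! (mk⇔ to from))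

module Enumeration {A : Set} {xs : List A} (xs! : Unique xs) (complete : ∀ x → x ∈ xs) where

  count : {P : Pred A 0ℓ} → Decidable P → ℕ
  count P? = length (filter P? xs)

  ∈filter⇒ : {P : Pred A 0ℓ} (P? : Decidable P) → ∀ {z} → z ∈ filter P? xs → P z
  ∈filter⇒ P? m = proj₂ (∈-filter⁻ P? {xs = xs} m)

  ⇒∈filter : {P : Pred A 0ℓ} (P? : Decidable P) → ∀ {z} → P z → z ∈ filter P? xs
  ⇒∈filter P? = ∈-filter⁺ P? (complete _)

  count≡length : {P : Pred A 0ℓ} (P? : Decidable P) {ys : List A} → Unique ys →
                 (∀ {z} → P z → z ∈ ys) → (∀ {z} → z ∈ ys → P z) → count P? ≡ length ys
  count≡length P? ys! to from = ↭-length (unique-set⇒↭ (Unique.filter⁺ P? xs!) ys!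
    (to ∘ ∈filter⇒ P?) (⇒∈filter P? ∘ from))

  count-singleton : {P : Pred A 0ℓ} (P? : Decidable P) {x : A} →
                    (∀ {z} → P z → z ≡ x) → P x → count P? ≡ 1
  count-singleton P? only px = count≡length P? ([] ∷ []) (here ∘ only) λ { (here refl) → px }

  count-pair : {P : Pred A 0ℓ} (P? : Decidable P) {x y : A} → x ≢ y →
               (∀ {z} → P z → z ≡ x ⊎ z ≡ y) → P x → P y → count P? ≡ 2
  count-pair {P} P? x≢y only px py = count≡length P? ((x≢y ∷ []) ∷ [] ∷ []) here-or-there
    λ { (here refl) → px ; (there (here refl)) → py }
    where
    here-or-there : ∀ {z} → P z → z ∈ _ ∷ _ ∷ []
    here-or-there pz with only pz
    ... | inj₁ z≡x = here z≡x
    ... | inj₂ z≡y = there (here z≡y)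

  count-all : {P : Pred A 0ℓ} (P? : Decidable P) → (∀ z → P z) → count P? ≡ length xs
  count-all P? all = cong length (filter-all P? (universal all xs))

  count-none : {P : Pred A 0ℓ} (P? : Decidable P) → (∀ z → ¬ P z) → count P? ≡ 0
  count-none P? none = cong length (filter-none P? (universal none xs))

  module _ {P Q : Pred A 0ℓ} (P? : Decidable P) (Q? : Decidable Q) where

    count-cong : (∀ {z} → P z → Q z) → (∀ {z} → Q z → P z) → count P? ≡ count Q?
    count-cong to from = count≡length P? (Unique.filter⁺ Q? xs!)
      (⇒∈filter Q? ∘ to) (from ∘ ∈filter⇒ Q?)

    count-⊎ : (∀ {z} → P z → Q z → ⊥) → count (P? ∪? Q?) ≡ count P? ℕ.+ count Q?
    count-⊎ disjoint = trans
      (count≡length (P? ∪? Q?) (Unique.++⁺ (Unique.filter⁺ P? xs!) (Unique.filter⁺ Q? xs!) separate) to from)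
      (length-++ (filter P? xs))
      where
      separate : ∀ {z} → z ∈ filter P? xs × z ∈ filter Q? xs → ⊥
      separate (p , q) = disjoint (∈filter⇒ P? p) (∈filter⇒ Q? q)
      to : ∀ {z} → P z ⊎ Q z → z ∈ filter P? xs ++ filter Q? xs
      to (inj₁ p) = ∈-++⁺ˡ (⇒∈filter P? p)
      to (inj₂ q) = ∈-++⁺ʳ (filter P? xs) (⇒∈filter Q? q)
      from : ∀ {z} → z ∈ filter P? xs ++ filter Q? xs → P z ⊎ Q z
      from m with ∈-++⁻ (filter P? xs) m
      ... | inj₁ p = inj₁ (∈filter⇒ P? p)
      ... | inj₂ q = inj₂ (∈filter⇒ Q? q)

    count-bijection : (σ : A → A) → (∀ {x y} → σ x ≡ σ y → x ≡ y) →
                      (∀ {x} → P x → Q (σ x)) → (∀ {y} → Q y → ∃ λ x → σ x ≡ y × P x) →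
                      count Q? ≡ count P?
    count-bijection σ injective to from = trans
      (count≡length Q? (Unique.map⁺ injective (Unique.filter⁺ P? xs!)) onto image)
      (length-map σ (filter P? xs))
      where
      onto : ∀ {y} → Q y → y ∈ map σ (filter P? xs)
      onto q with from q
      ... | x , refl , p = ∈-map⁺ σ (⇒∈filter P? p)
      image : ∀ {y} → y ∈ map σ (filter P? xs) → Q y
      image m with ∈-map⁻ σ m
      ... | x , mx , refl = to (∈filter⇒ P? mx)

    count-involution : (σ : A → A) → (∀ x → σ (σ x) ≡ x) →
                       (∀ {x} → P x → Q (σ x)) → (∀ {x} → Q x → P (σ x)) → count Q? ≡ count P?
    count-involution σ σσ to from = count-bijection σ injective to (λ {y} q → σ y , σσ y , from q)
      where
      injective : ∀ {x y} → σ x ≡ σ y → x ≡ y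
      injective {x} {y} e = trans (sym (σσ x)) (trans (cong σ e) (σσ y))

  count+count-∁ : {P : Pred A 0ℓ} (P? : Decidable P) → count P? ℕ.+ count (∁? P?) ≡ length xs
  count+count-∁ {P} P? = trans (sym (count-⊎ P? (∁? P?) λ p ¬p → ¬p p)) (count-all (P? ∪? ∁? P?) excluded-middle)
    where
    excluded-middle : ∀ z → P z ⊎ ¬ P z
    excluded-middle z with P? z
    ... | yes p = inj₁ p
    ... | no ¬p = inj₂ ¬p

  count-halves : {P : Pred A 0ℓ} (P? : Decidable P) (σ : A → A) → (∀ x → σ (σ x) ≡ x) →
                 (∀ {x} → P x → ¬ P (σ x)) → (∀ {x} → ¬ P x → P (σ x)) →
                 count P? ℕ.+ count P? ≡ length xs
  count-halves P? σ σσ to from =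
    trans (cong (count P? ℕ.+_) (sym (count-involution P? (∁? P?) σ σσ to from))) (count+count-∁ P?)

  count-graph : {T : Pred (A × A) 0ℓ} {S : Pred A 0ℓ} (T? : Decidable T) (S? : Decidable S) (φ : A → A) →
                (∀ {r r'} → T (r , r') → r' ≡ φ r × S r) → (∀ {r} → S r → T (r , φ r)) →
                length (filter T? (cartesianProduct xs xs)) ≡ count S?
  count-graph T? S? φ to from = trans
    (↭-length (unique-set⇒↭ (Unique.filter⁺ T? (Unique.cartesianProduct⁺ xs! xs!))
                            (Unique.map⁺ (cong proj₁) (Unique.filter⁺ S? xs!)) onto image))
    (length-map _ (filter S? xs))
    where
    onto : ∀ {p} → p ∈ filter T? (cartesianProduct xs xs) → p ∈ map (λ r → r , φ r) (filter S? xs)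
    onto {r , r'} m with to (proj₂ (∈-filter⁻ T? {xs = cartesianProduct xs xs} m))
    ... | refl , s = ∈-map⁺ _ (⇒∈filter S? s)
    image : ∀ {p} → p ∈ map (λ r → r , φ r) (filter S? xs) → p ∈ filter T? (cartesianProduct xs xs)
    image m with ∈-map⁻ _ m
    ... | r , mr , refl = ∈-filter⁺ T? (∈-cartesianProduct⁺ (complete r) (complete (φ r)))
                                    (from (∈filter⇒ S? mr))

2^[2k+1]≡2^[2k]*2 : ∀ k → 2 ℕ.^ (2 ℕ.* k ℕ.+ 1) ≡ 2 ℕ.^ (2 ℕ.* k) ℕ.* 2
2^[2k+1]≡2^[2k]*2 k = trans (cong (2 ℕ.^_) (ℕₚ.+-comm (2 ℕ.* k) 1)) (ℕₚ.*-comm 2 (2 ℕ.^ (2 ℕ.* k)))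

c+c≡2^[1+j]⇒c≡2^j : ∀ j {c} → c ℕ.+ c ≡ 2 ℕ.^ suc j → c ≡ 2 ℕ.^ j
c+c≡2^[1+j]⇒c≡2^j j {c} c+c≡2^[1+j] =
  ℕₚ.*-cancelˡ-≡ c (2 ℕ.^ j) 2 (trans (cong (c ℕ.+_) (ℕₚ.+-identityʳ c)) c+c≡2^[1+j])

2^[2j+1]≡3m+2 : ∀ j → ∃ λ m → 2 ℕ.^ (2 ℕ.* j ℕ.+ 1) ≡ 3 ℕ.* m ℕ.+ 2
2^[2j+1]≡3m+2 zero    = 0 , refl
2^[2j+1]≡3m+2 (suc j) with 2^[2j+1]≡3m+2 j
... | m , 2^[2j+1]≡3m+2 = 4 ℕ.* m ℕ.+ 2 , (begin
  2 ℕ.^ (2 ℕ.* suc j ℕ.+ 1)            ≡⟨ cong (2 ℕ.^_) (exponent j) ⟩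
  2 ℕ.* (2 ℕ.* 2 ℕ.^ (2 ℕ.* j ℕ.+ 1))  ≡⟨ cong (λ t → 2 ℕ.* (2 ℕ.* t)) 2^[2j+1]≡3m+2 ⟩
  2 ℕ.* (2 ℕ.* (3 ℕ.* m ℕ.+ 2))        ≡⟨ four-times m ⟩
  3 ℕ.* (4 ℕ.* m ℕ.+ 2) ℕ.+ 2          ∎)
  where
  open ≡-Reasoning
  exponent : ∀ j → 2 ℕ.* suc j ℕ.+ 1 ≡ 2 ℕ.+ (2 ℕ.* j ℕ.+ 1)
  exponent = solve-∀
  four-times : ∀ m → 2 ℕ.* (2 ℕ.* (3 ℕ.* m ℕ.+ 2)) ≡ 3 ℕ.* (4 ℕ.* m ℕ.+ 2) ℕ.+ 2
  four-times = solve-∀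

module FiniteFieldProperties {n : ℕ} (F : FiniteField2^ n) where

  open FiniteField2^ F
  open IsCommutativeRing isCommutativeRing
    using (+-assoc; +-identityˡ; +-identityʳ; -‿inverseʳ;
           *-assoc; *-comm; *-identityˡ; *-identityʳ; distribˡ; zeroˡ; zeroʳ; *-isCommutativeMonoid)
  open Enumeration unique complete public
  open ≡-Reasoning

  commutativeRing : CommutativeRing 0ℓ 0ℓ
  commutativeRing = record
    { Carrier = Carrier ; _≈_ = _≡_ ; _+_ = _+_ ; _*_ = _*_ ; -_ = -_ ; 0# = 0# ; 1# = 1#
    ; isCommutativeRing = isCommutativeRing }

  open import Tactic.RingSolver.NonReflective (fromCommutativeRing commutativeRing (λ _ → nothing))
    using (solve; _⊜_; _⊕_; _⊗_) public
  open import Algebra.Solver.CommutativeMonoid (CommutativeRing.*-commutativeMonoid commutativeRing)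
    using () renaming (solve to *-solve; _⊜_ to _⊜*_; _⊕_ to _·_) public
  open import Algebra.Properties.Ring (CommutativeRing.ring commutativeRing)
    using (-1*x≈-x; -‿involutive; +-cancelˡ; +-cancelʳ; +-inverseʳ-unique; x+x≈x⇒x≈0) public

  ^-homo-* : ∀ x m p → x ^ (m ℕ.+ p) ≡ x ^ m * x ^ p
  ^-homo-* x zero    p = sym (*-identityˡ _)
  ^-homo-* x (suc m) p = trans (cong (x *_) (^-homo-* x m p)) (sym (*-assoc x _ _))

  ^-distrib-* : ∀ x y m → (x * y) ^ m ≡ x ^ m * y ^ m
  ^-distrib-* x y zero    = sym (*-identityˡ _)
  ^-distrib-* x y (suc m) = trans (cong ((x * y) *_) (^-distrib-* x y m))
    (*-solve 4 (λ x y u v → ((x · y) · (u · v)) ⊜* ((x · u) · (y · v))) refl x y (x ^ m) (y ^ m))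

  ^-zeroˡ : ∀ p → 1# ^ p ≡ 1#
  ^-zeroˡ zero    = refl
  ^-zeroˡ (suc p) = trans (*-identityˡ _) (^-zeroˡ p)

  ^-assocʳ : ∀ x m p → (x ^ m) ^ p ≡ x ^ (m ℕ.* p)
  ^-assocʳ x zero    p = ^-zeroˡ p
  ^-assocʳ x (suc m) p = begin
    (x * x ^ m) ^ p         ≡⟨ ^-distrib-* x (x ^ m) p ⟩
    x ^ p * (x ^ m) ^ p     ≡⟨ cong (x ^ p *_) (^-assocʳ x m p) ⟩
    x ^ p * x ^ (m ℕ.* p)   ≡⟨ ^-homo-* x p (m ℕ.* p) ⟨
    x ^ (p ℕ.+ m ℕ.* p)     ∎

  x^2≡x*x : ∀ x → x ^ 2 ≡ x * x
  x^2≡x*x x = cong (x *_) (*-identityʳ x)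

  x^3≡x*x*x : ∀ x → x ^ 3 ≡ x * (x * x)
  x^3≡x*x*x x = cong (x *_) (x^2≡x*x x)

  x^2^[1+i]≡square : ∀ x i → x ^ (2 ℕ.^ suc i) ≡ x ^ (2 ℕ.^ i) * x ^ (2 ℕ.^ i)
  x^2^[1+i]≡square x i = trans (cong (x ^_) (ℕₚ.*-comm 2 (2 ℕ.^ i)))
                                (trans (sym (^-assocʳ x (2 ℕ.^ i) 2)) (x^2≡x*x _))

  1≢0 : 1# ≢ 0#
  1≢0 = 0≢1 ∘ sym

  ⁻¹-inverseˡ : ∀ x → x ≢ 0# → x ⁻¹ * x ≡ 1#
  ⁻¹-inverseˡ x x≢0 = trans (*-comm _ _) (⁻¹-inverse x x≢0)

  *-cancelˡ : ∀ x {y z} → x ≢ 0# → x * y ≡ x * z → y ≡ z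
  *-cancelˡ x {y} {z} x≢0 xy≡xz = begin
    y                 ≡⟨ *-identityˡ y ⟨
    1# * y            ≡⟨ cong (_* y) (⁻¹-inverseˡ x x≢0) ⟨
    (x ⁻¹ * x) * y    ≡⟨ *-assoc _ _ _ ⟩
    x ⁻¹ * (x * y)    ≡⟨ cong (x ⁻¹ *_) xy≡xz ⟩
    x ⁻¹ * (x * z)    ≡⟨ *-assoc _ _ _ ⟨
    (x ⁻¹ * x) * z    ≡⟨ cong (_* z) (⁻¹-inverseˡ x x≢0) ⟩
    1# * z            ≡⟨ *-identityˡ z ⟩
    z                 ∎

  *-≢0 : ∀ {x y} → x ≢ 0# → y ≢ 0# → x * y ≢ 0#
  *-≢0 {x} {y} x≢0 y≢0 xy≡0 = y≢0 (*-cancelˡ x x≢0 (trans xy≡0 (sym (zeroʳ x))))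

  ⁻¹-≢0 : ∀ {x} → x ≢ 0# → x ⁻¹ ≢ 0#
  ⁻¹-≢0 {x} x≢0 x⁻¹≡0 = 1≢0 (trans (sym (⁻¹-inverse x x≢0)) (trans (cong (x *_) x⁻¹≡0) (zeroʳ x)))

  idempotent⇒≡1 : ∀ {t} → t * t ≡ t → t ≢ 0# → t ≡ 1#
  idempotent⇒≡1 {t} tt≡t t≢0 = *-cancelˡ t t≢0 (trans tt≡t (sym (*-identityʳ t)))

  nonzero? : Decidable (_≢ 0#)
  nonzero? = ∁? (_≟ 0#)

  nonzeros : List Carrier
  nonzeros = filter nonzero? elements

  1+#nonzeros≡2^n : suc (length nonzeros) ≡ 2 ℕ.^ n
  1+#nonzeros≡2^n = begin
    1 ℕ.+ count nonzero?                ≡⟨ cong (ℕ._+ count nonzero?) #zeros≡1 ⟨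
    count (_≟ 0#) ℕ.+ count nonzero?    ≡⟨ count+count-∁ (_≟ 0#) ⟩
    length elements                     ≡⟨ card ⟩
    2 ℕ.^ n                             ∎
    where
    #zeros≡1 : count (_≟ 0#) ≡ 1
    #zeros≡1 = count-singleton (_≟ 0#) id refl

  product : List Carrier → Carrier
  product = foldr _*_ 1#

  product-↭ : ∀ {xs ys} → xs ↭ ys → product xs ≡ product ys
  product-↭ xs↭ys = foldr-commMonoid (setoid Carrier) *-isCommutativeMonoid (↭⇒↭ₛ xs↭ys)

  product-map-* : ∀ x ys → product (map (x *_) ys) ≡ x ^ length ys * product ys
  product-map-* x []       = sym (*-identityˡ _)
  product-map-* x (y ∷ ys) = trans (cong ((x * y) *_) (product-map-* x ys))
    (*-solve 4 (λ x y u v → ((x · y) · (u · v)) ⊜* ((x · u) · (y · v))) refl x y _ _)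

  product-≢0 : ∀ ys → (∀ {z} → z ∈ ys → z ≢ 0#) → product ys ≢ 0#
  product-≢0 []       _       = 1≢0
  product-≢0 (y ∷ ys) all≢0 = *-≢0 (all≢0 (here refl)) (product-≢0 ys (all≢0 ∘ there))

  -- Multiplication by x ≢ 0 permutes the nonzero elements, so it fixes their product.
  x^#nonzeros≡1 : ∀ {x} → x ≢ 0# → x ^ length nonzeros ≡ 1#
  x^#nonzeros≡1 {x} x≢0 = *-cancelˡ (product nonzeros) (product-≢0 nonzeros (∈filter⇒ nonzero?)) (begin
    product nonzeros * x ^ length nonzeros   ≡⟨ *-comm _ _ ⟩
    x ^ length nonzeros * product nonzeros   ≡⟨ product-map-* x nonzeros ⟨
    product (map (x *_) nonzeros)            ≡⟨ product-↭ x*-permutes ⟩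
    product nonzeros                         ≡⟨ *-identityʳ _ ⟨
    product nonzeros * 1#                    ∎)
    where
    x*-permutes : map (x *_) nonzeros ↭ nonzeros
    x*-permutes = unique-set⇒↭ (Unique.map⁺ (*-cancelˡ x x≢0) (Unique.filter⁺ nonzero? unique))
                               (Unique.filter⁺ nonzero? unique) into onto
      where
      into : ∀ {z} → z ∈ map (x *_) nonzeros → z ∈ nonzeros
      into m with ∈-map⁻ (x *_) m
      ... | u , u∈ , refl = ⇒∈filter nonzero? (*-≢0 x≢0 (∈filter⇒ nonzero? u∈))
      onto : ∀ {z} → z ∈ nonzeros → z ∈ map (x *_) nonzeros
      onto {z} z∈ = subst (_∈ map (x *_) nonzeros) x*x⁻¹z≡z
        (∈-map⁺ (x *_) (⇒∈filter nonzero? (*-≢0 (⁻¹-≢0 x≢0) (∈filter⇒ nonzero? z∈))))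
        where
        x*x⁻¹z≡z : x * (x ⁻¹ * z) ≡ z
        x*x⁻¹z≡z = trans (sym (*-assoc _ _ _)) (trans (cong (_* z) (⁻¹-inverse x x≢0)) (*-identityˡ z))

  x^2^n≡x : ∀ x → x ^ (2 ℕ.^ n) ≡ x
  x^2^n≡x x with x ≟ 0#
  ... | yes refl = subst (λ m → 0# ^ m ≡ 0#) 1+#nonzeros≡2^n (zeroˡ _)
  ... | no x≢0   = subst (λ m → x ^ m ≡ x) 1+#nonzeros≡2^n
                     (trans (cong (x *_) (x^#nonzeros≡1 x≢0)) (*-identityʳ x))

  n≢0 : n ≢ 0
  n≢0 refl with elements | complete 0# | complete 1# | card
  ... | _ ∷ [] | here 0≡x | here 1≡x | _ = 0≢1 (trans 0≡x (sym 1≡x))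

  -- Characteristic 2 is not part of the record: it follows from x ^ (2 ^ n) ≡ x at x = -1,
  -- because 2 ^ n is even.
  -1≡1 : - 1# ≡ 1#
  -1≡1 = begin
    - 1#                                  ≡⟨ x^2^n≡x (- 1#) ⟨
    (- 1#) ^ (2 ℕ.^ n)                    ≡⟨ cong (λ m → (- 1#) ^ (2 ℕ.^ m)) (ℕₚ.suc-pred n) ⟨
    (- 1#) ^ (2 ℕ.* 2 ℕ.^ ℕ.pred n)       ≡⟨ ^-assocʳ (- 1#) 2 (2 ℕ.^ ℕ.pred n) ⟨
    ((- 1#) ^ 2) ^ (2 ℕ.^ ℕ.pred n)       ≡⟨ cong (_^ (2 ℕ.^ ℕ.pred n)) -1^2≡1 ⟩
    1# ^ (2 ℕ.^ ℕ.pred n)                 ≡⟨ ^-zeroˡ (2 ℕ.^ ℕ.pred n) ⟩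
    1#                                    ∎
    where
    instance
      n-nonZero : ℕ.NonZero n
      n-nonZero = ℕ.≢-nonZero n≢0
    -1^2≡1 : (- 1#) ^ 2 ≡ 1#
    -1^2≡1 = trans (x^2≡x*x (- 1#)) (trans (-1*x≈-x (- 1#)) (-‿involutive 1#))

  1+1≡0 : 1# + 1# ≡ 0#
  1+1≡0 = trans (cong (1# +_) (sym -1≡1)) (-‿inverseʳ 1#)

  x+x≡0 : ∀ x → x + x ≡ 0#
  x+x≡0 x = begin
    x + x               ≡⟨ cong₂ _+_ (*-identityʳ x) (*-identityʳ x) ⟨
    x * 1# + x * 1#     ≡⟨ distribˡ x 1# 1# ⟨
    x * (1# + 1#)       ≡⟨ cong (x *_) 1+1≡0 ⟩
    x * 0#              ≡⟨ zeroʳ x ⟩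
    0#                  ∎

  -x≡x : ∀ x → - x ≡ x
  -x≡x x = sym (+-inverseʳ-unique x x (x+x≡0 x))

  x+y≡0⇒x≡y : ∀ {x y} → x + y ≡ 0# → x ≡ y
  x+y≡0⇒x≡y {x} {y} x+y≡0 = sym (trans (+-inverseʳ-unique x y x+y≡0) (-x≡x x))

  x+c+c≡x : ∀ x c → (x + c) + c ≡ x
  x+c+c≡x x c = trans (+-assoc x c c) (trans (cong (x +_) (x+x≡0 c)) (+-identityʳ x))

  x≢x+c : ∀ {c} x → c ≢ 0# → x ≢ x + c
  x≢x+c {c} x c≢0 x≡x+c = c≢0 (sym (+-cancelˡ x 0# c (trans (+-identityʳ x) x≡x+c)))

  square-+ : ∀ x y → (x + y) * (x + y) ≡ x * x + y * y
  square-+ x y = begin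
    (x + y) * (x + y)
      ≡⟨ solve 2 (λ x y → ((x ⊕ y) ⊗ (x ⊕ y)) ⊜ ((x ⊗ x ⊕ y ⊗ y) ⊕ (x ⊗ y ⊕ x ⊗ y))) refl x y ⟩
    (x * x + y * y) + (x * y + x * y)   ≡⟨ cong ((x * x + y * y) +_) (x+x≡0 (x * y)) ⟩
    (x * x + y * y) + 0#                ≡⟨ +-identityʳ _ ⟩
    x * x + y * y                       ∎

  ^2^i-homo-+ : ∀ i x y → (x + y) ^ (2 ℕ.^ i) ≡ x ^ (2 ℕ.^ i) + y ^ (2 ℕ.^ i)
  ^2^i-homo-+ zero    x y = trans (*-identityʳ _) (sym (cong₂ _+_ (*-identityʳ x) (*-identityʳ y)))
  ^2^i-homo-+ (suc i) x y = begin
    (x + y) ^ (2 ℕ.^ suc i)                                          ≡⟨ x^2^[1+i]≡square (x + y) i ⟩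
    (x + y) ^ (2 ℕ.^ i) * (x + y) ^ (2 ℕ.^ i)                        ≡⟨ cong₂ _*_ (^2^i-homo-+ i x y) (^2^i-homo-+ i x y) ⟩
    (x ^ (2 ℕ.^ i) + y ^ (2 ℕ.^ i)) * (x ^ (2 ℕ.^ i) + y ^ (2 ℕ.^ i)) ≡⟨ square-+ _ _ ⟩
    x ^ (2 ℕ.^ i) * x ^ (2 ℕ.^ i) + y ^ (2 ℕ.^ i) * y ^ (2 ℕ.^ i)
      ≡⟨ cong₂ _+_ (x^2^[1+i]≡square x i) (x^2^[1+i]≡square y i) ⟨
    x ^ (2 ℕ.^ suc i) + y ^ (2 ℕ.^ suc i)                            ∎

  traceSum-homo-+ : ∀ i x y → traceSum i (x + y) ≡ traceSum i x + traceSum i y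
  traceSum-homo-+ zero    x y = sym (+-identityʳ 0#)
  traceSum-homo-+ (suc i) x y = trans (cong₂ _+_ (^2^i-homo-+ i x y) (traceSum-homo-+ i x y))
    (solve 4 (λ a b c d → ((a ⊕ b) ⊕ (c ⊕ d)) ⊜ ((a ⊕ c) ⊕ (b ⊕ d))) refl _ _ _ _)

  Tr-homo-+ : ∀ x y → Tr (x + y) ≡ Tr x + Tr y
  Tr-homo-+ = traceSum-homo-+ n

  Tr-0 : Tr 0# ≡ 0#
  Tr-0 = x+x≈x⇒x≈0 (Tr 0#) (trans (sym (Tr-homo-+ 0# 0#)) (cong Tr (+-identityʳ 0#)))

  traceSum-square : ∀ i x → traceSum i x * traceSum i x ≡ traceSum i (x * x)
  traceSum-square zero    x = zeroˡ 0#
  traceSum-square (suc i) x = trans (square-+ _ _)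
    (cong₂ _+_ (sym (^-distrib-* x x (2 ℕ.^ i))) (traceSum-square i x))

  traceSum-shift : ∀ i x → traceSum i (x * x) + x ≡ traceSum i x + x ^ (2 ℕ.^ i)
  traceSum-shift zero    x = cong (0# +_) (sym (*-identityʳ x))
  traceSum-shift (suc i) x = begin
    ((x * x) ^ (2 ℕ.^ i) + traceSum i (x * x)) + x     ≡⟨ +-assoc _ _ _ ⟩
    (x * x) ^ (2 ℕ.^ i) + (traceSum i (x * x) + x)     ≡⟨ cong₂ _+_ x²^2^i≡x^2^[1+i] (traceSum-shift i x) ⟩
    x ^ (2 ℕ.^ suc i) + (traceSum i x + x ^ (2 ℕ.^ i))
      ≡⟨ solve 3 (λ a t b → (a ⊕ (t ⊕ b)) ⊜ ((b ⊕ t) ⊕ a)) refl _ _ _ ⟩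
    (x ^ (2 ℕ.^ i) + traceSum i x) + x ^ (2 ℕ.^ suc i) ∎
    where
    x²^2^i≡x^2^[1+i] : (x * x) ^ (2 ℕ.^ i) ≡ x ^ (2 ℕ.^ suc i)
    x²^2^i≡x^2^[1+i] = trans (^-distrib-* x x (2 ℕ.^ i)) (sym (x^2^[1+i]≡square x i))

  Tr-square : ∀ x → Tr (x * x) ≡ Tr x
  Tr-square x = +-cancelʳ x _ _ (trans (traceSum-shift n x) (cong (Tr x +_) (x^2^n≡x x)))

  IsBit : Carrier → Set
  IsBit t = t ≡ 0# ⊎ t ≡ 1#

  Tr-bit : ∀ x → IsBit (Tr x)
  Tr-bit x with Tr x ≟ 0#
  ... | yes Trx≡0 = inj₁ Trx≡0
  ... | no  Trx≢0 = inj₂ (idempotent⇒≡1 (trans (traceSum-square n x) (Tr-square x)) Trx≢0)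

  IsBit-+ : ∀ {s t} → IsBit s → IsBit t → IsBit (s + t)
  IsBit-+ (inj₁ refl) (inj₁ refl) = inj₁ (+-identityˡ 0#)
  IsBit-+ (inj₁ refl) (inj₂ refl) = inj₂ (+-identityˡ 1#)
  IsBit-+ (inj₂ refl) (inj₁ refl) = inj₂ (+-identityʳ 1#)
  IsBit-+ (inj₂ refl) (inj₂ refl) = inj₁ 1+1≡0

  IsBit-≢0⇒≡1 : ∀ {t} → IsBit t → t ≢ 0# → t ≡ 1#
  IsBit-≢0⇒≡1 (inj₁ t≡0) t≢0 = ⊥-elim (t≢0 t≡0)
  IsBit-≢0⇒≡1 (inj₂ t≡1) _   = t≡1

  traceSum-1-even : ∀ j → traceSum (j ℕ.+ j) 1# ≡ 0#
  traceSum-1-even zero    = refl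
  traceSum-1-even (suc j) = begin
    traceSum (suc j ℕ.+ suc j) 1#                            ≡⟨ cong (λ m → traceSum (suc m) 1#) (ℕₚ.+-suc j j) ⟩
    1# ^ (2 ℕ.^ suc (j ℕ.+ j)) + (1# ^ (2 ℕ.^ (j ℕ.+ j)) + traceSum (j ℕ.+ j) 1#)
      ≡⟨ cong₂ (λ s t → s + (t + traceSum (j ℕ.+ j) 1#))
               (^-zeroˡ (2 ℕ.^ suc (j ℕ.+ j))) (^-zeroˡ (2 ℕ.^ (j ℕ.+ j))) ⟩
    1# + (1# + traceSum (j ℕ.+ j) 1#)                        ≡⟨ cong (λ t → 1# + (1# + t)) (traceSum-1-even j) ⟩
    1# + (1# + 0#)                                           ≡⟨ cong (1# +_) (+-identityʳ 1#) ⟩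
    1# + 1#                                                  ≡⟨ 1+1≡0 ⟩
    0#                                                       ∎

  preimages-∘-permutation : ∀ {g} → IsPermutation g → ∀ φ y → preimages (φ ∘ g) y ≡ preimages φ y
  preimages-∘-permutation {g} (g-injective , g-surjective) φ y =
    sym (count-bijection (λ x → φ (g x) ≟ y) (λ u → φ u ≟ y) g (g-injective _ _) id from)
    where
    from : ∀ {u} → φ u ≡ y → ∃ λ x → g x ≡ u × φ (g x) ≡ y
    from {u} φu≡y with g-surjective u
    ... | x , refl = x , refl , φu≡y

  diffCount≡count : ∀ {R : Pred Carrier 0ℓ} (R? : Decidable R) {d} → d ≢ 0# →
                    diffCount R? d ≡ count (λ r → R? r ×-dec R? (r + d))
  diffCount≡count {R} R? {d} d≢0 = count-graph _ (λ r → R? r ×-dec R? (r + d)) (_+ d) to from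
    where
    to : ∀ {r r'} → R r × R r' × r ≢ r' × r + - r' ≡ d → r' ≡ r + d × R r × R (r + d)
    to {r} {r'} (Rr , Rr' , _ , r-r'≡d) = r'≡r+d , Rr , subst _ r'≡r+d Rr'
      where
      r'≡r+d : r' ≡ r + d
      r'≡r+d = sym (x+y≡0⇒x≡y (begin
        (r + d) + r'        ≡⟨ cong ((r + d) +_) (-x≡x r') ⟨
        (r + d) + - r'      ≡⟨ solve 3 (λ r d s → ((r ⊕ d) ⊕ s) ⊜ (d ⊕ (r ⊕ s))) refl r d (- r') ⟩
        d + (r + - r')      ≡⟨ cong (d +_) r-r'≡d ⟩
        d + d               ≡⟨ x+x≡0 d ⟩
        0#                  ∎))
    from : ∀ {r} → R r × R (r + d) → R r × R (r + d) × r ≢ r + d × r + - (r + d) ≡ d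
    from {r} (Rr , Rr+d) = Rr , Rr+d , x≢x+c r d≢0 , (begin
      r + - (r + d)       ≡⟨ cong (r +_) (-x≡x (r + d)) ⟩
      r + (r + d)         ≡⟨ +-assoc r r d ⟨
      (r + r) + d         ≡⟨ cong (_+ d) (x+x≡0 r) ⟩
      0# + d              ≡⟨ +-identityˡ d ⟩
      d                   ∎)

  0-or-c-isAddSubgroup : ∀ c → IsAddSubgroup (λ y → (y ≟ 0#) ⊎-dec (y ≟ c))
  0-or-c-isAddSubgroup c = inj₁ refl , closed , λ x → subst (λ t → t ≡ 0# ⊎ t ≡ c) (sym (-x≡x x))
    where
    closed : ∀ x y → x ≡ 0# ⊎ x ≡ c → y ≡ 0# ⊎ y ≡ c → x + y ≡ 0# ⊎ x + y ≡ c
    closed _ _ (inj₁ refl) (inj₁ refl) = inj₁ (+-identityˡ 0#)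
    closed _ _ (inj₁ refl) (inj₂ refl) = inj₂ (+-identityˡ c)
    closed _ _ (inj₂ refl) (inj₁ refl) = inj₂ (+-identityʳ c)
    closed _ _ (inj₂ refl) (inj₂ refl) = inj₁ (x+x≡0 c)

  count-0-or-c : ∀ {c} → c ≢ 0# → count (λ y → (y ≟ 0#) ⊎-dec (y ≟ c)) ≡ 2
  count-0-or-c c≢0 = count-pair _ (c≢0 ∘ sym) id (inj₁ refl) (inj₂ refl)

  module OddDegree (k : ℕ) (n≡2k+1 : n ≡ 2 ℕ.* k ℕ.+ 1) where

    n≡1+2k : n ≡ suc (2 ℕ.* k)
    n≡1+2k = trans n≡2k+1 (ℕₚ.+-comm (2 ℕ.* k) 1)

    #F≡2^[1+2k] : length elements ≡ 2 ℕ.^ suc (2 ℕ.* k)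
    #F≡2^[1+2k] = trans card (cong (2 ℕ.^_) n≡1+2k)

    Tr-1 : Tr 1# ≡ 1#
    Tr-1 = begin
      traceSum n 1#                                    ≡⟨ cong (λ m → traceSum m 1#) n≡1+2k ⟩
      1# ^ (2 ℕ.^ (2 ℕ.* k)) + traceSum (2 ℕ.* k) 1#   ≡⟨ cong₂ _+_ (^-zeroˡ (2 ℕ.^ (2 ℕ.* k))) 2k-even ⟩
      1# + 0#                                          ≡⟨ +-identityʳ 1# ⟩
      1#                                               ∎
      where
      2k-even : traceSum (2 ℕ.* k) 1# ≡ 0#
      2k-even = trans (cong (λ m → traceSum (k ℕ.+ m) 1#) (ℕₚ.+-identityʳ k)) (traceSum-1-even k)

    x^3≡1⇒x≡1 : ∀ {x} → x ^ 3 ≡ 1# → x ≡ 1#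
    x^3≡1⇒x≡1 {x} x³≡1 with 2^[2j+1]≡3m+2 k
    ... | m , 2^n≡3m+2 = idempotent⇒≡1 x*x≡x x≢0
      where
      x≢0 : x ≢ 0#
      x≢0 x≡0 = 1≢0 (trans (sym x³≡1) (trans (cong (_^ 3) x≡0) (zeroˡ _)))
      x*x≡x : x * x ≡ x
      x*x≡x = begin
        x * x                   ≡⟨ x^2≡x*x x ⟨
        x ^ 2                   ≡⟨ *-identityˡ _ ⟨
        1# * x ^ 2              ≡⟨ cong (_* x ^ 2) (trans (cong (_^ m) x³≡1) (^-zeroˡ m)) ⟨
        (x ^ 3) ^ m * x ^ 2     ≡⟨ cong (_* x ^ 2) (^-assocʳ x 3 m) ⟩
        x ^ (3 ℕ.* m) * x ^ 2   ≡⟨ ^-homo-* x (3 ℕ.* m) 2 ⟨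
        x ^ (3 ℕ.* m ℕ.+ 2)     ≡⟨ cong (x ^_) (trans (cong (2 ℕ.^_) n≡2k+1) 2^n≡3m+2) ⟨
        x ^ (2 ℕ.^ n)           ≡⟨ x^2^n≡x x ⟩
        x                       ∎

    √_ : Carrier → Carrier
    √ x = x ^ (2 ℕ.^ (2 ℕ.* k))

    √x*√x≡x : ∀ x → √ x * √ x ≡ x
    √x*√x≡x x = begin
      √ x * √ x                   ≡⟨ x^2^[1+i]≡square x (2 ℕ.* k) ⟨
      x ^ (2 ℕ.^ suc (2 ℕ.* k))   ≡⟨ cong (λ m → x ^ (2 ℕ.^ m)) n≡1+2k ⟨
      x ^ (2 ℕ.^ n)               ≡⟨ x^2^n≡x x ⟩
      x                           ∎

    √[x*x]≡x : ∀ x → √ (x * x) ≡ x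
    √[x*x]≡x x = trans (^-distrib-* x x (2 ℕ.^ (2 ℕ.* k))) (√x*√x≡x x)

module CubicTrace (k : ℕ) (F : FiniteField2^ (2 ℕ.* k ℕ.+ 1)) (a : FiniteField2^.Carrier F)
                  (a≢0 : a ≢ FiniteField2^.0# F) where

  open FiniteField2^ F
  open FiniteFieldProperties F
  open OddDegree k refl
  open IsCommutativeRing isCommutativeRing
    using (+-identityˡ; +-identityʳ; *-assoc; *-comm; *-identityˡ; *-identityʳ; distribˡ; distribʳ; zeroʳ)
  open ≡-Reasoning

  b A : Carrier
  b = a ⁻¹
  A = a ^ 3

  h : Carrier → Carrier
  h y = Tr (A * y ^ 3)

  -- Tr (A * (y * y) * d) = Tr (y * √ (A * d)), so the cross terms of h (y + d) are linear in y.
  D : Carrier → Carrier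
  D d = √ (A * d) + A * (d * d)

  ab≡1 : a * b ≡ 1#
  ab≡1 = ⁻¹-inverse a a≢0

  A≢0 : A ≢ 0#
  A≢0 = *-≢0 a≢0 (*-≢0 a≢0 (*-≢0 a≢0 1≢0))

  cube-+ : ∀ y d → (y + d) ^ 3 ≡ (y ^ 3 + ((y * y) * d + y * (d * d))) + d ^ 3
  cube-+ y d = begin
    (y + d) ^ 3                                                   ≡⟨ x^3≡x*x*x (y + d) ⟩
    (y + d) * ((y + d) * (y + d))                                 ≡⟨ cong ((y + d) *_) (square-+ y d) ⟩
    (y + d) * (y * y + d * d)                                     ≡⟨ distribʳ _ y d ⟩
    y * (y * y + d * d) + d * (y * y + d * d)                     ≡⟨ cong₂ _+_ (distribˡ y _ _) (distribˡ d _ _) ⟩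
    (y * (y * y) + y * (d * d)) + (d * (y * y) + d * (d * d))
      ≡⟨ solve 4 (λ p q r s → ((p ⊕ q) ⊕ (r ⊕ s)) ⊜ ((p ⊕ (r ⊕ q)) ⊕ s)) refl _ _ _ _ ⟩
    (y * (y * y) + (d * (y * y) + y * (d * d))) + d * (d * d)
      ≡⟨ cong₂ (λ s t → (s + (t + y * (d * d))) + d * (d * d)) (x^3≡x*x*x y) (*-comm (y * y) d) ⟨
    (y ^ 3 + ((y * y) * d + y * (d * d))) + d * (d * d)           ≡⟨ cong ((y ^ 3 + ((y * y) * d + y * (d * d))) +_) (x^3≡x*x*x d) ⟨
    (y ^ 3 + ((y * y) * d + y * (d * d))) + d ^ 3                 ∎

  polar : ∀ y d → Tr (A * ((y * y) * d)) + Tr (A * (y * (d * d))) ≡ Tr (y * D d)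
  polar y d = begin
    Tr (A * ((y * y) * d)) + Tr (A * (y * (d * d)))   ≡⟨ cong₂ (λ s t → Tr s + Tr t) square-term linear-term ⟩
    Tr ((y * c) * (y * c)) + Tr (y * (A * (d * d)))   ≡⟨ cong (_+ Tr (y * (A * (d * d)))) (Tr-square (y * c)) ⟩
    Tr (y * c) + Tr (y * (A * (d * d)))               ≡⟨ Tr-homo-+ _ _ ⟨
    Tr (y * c + y * (A * (d * d)))                    ≡⟨ cong Tr (distribˡ y c _) ⟨
    Tr (y * D d)                                      ∎
    where
    c = √ (A * d)
    square-term : A * ((y * y) * d) ≡ (y * c) * (y * c)
    square-term = begin
      A * ((y * y) * d)     ≡⟨ *-solve 3 (λ A y d → (A · ((y · y) · d)) ⊜* ((y · y) · (A · d))) refl A y d ⟩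
      (y * y) * (A * d)     ≡⟨ cong ((y * y) *_) (√x*√x≡x (A * d)) ⟨
      (y * y) * (c * c)     ≡⟨ *-solve 2 (λ y c → ((y · y) · (c · c)) ⊜* ((y · c) · (y · c))) refl y c ⟩
      (y * c) * (y * c)     ∎
    linear-term : A * (y * (d * d)) ≡ y * (A * (d * d))
    linear-term = *-solve 3 (λ A y d → (A · (y · (d · d))) ⊜* (y · (A · (d · d)))) refl A y d

  h-+ : ∀ y d → h (y + d) ≡ (h y + Tr (y * D d)) + h d
  h-+ y d = begin
    Tr (A * (y + d) ^ 3)                                       ≡⟨ cong (λ t → Tr (A * t)) (cube-+ y d) ⟩
    Tr (A * ((y ^ 3 + (P + Q)) + d ^ 3))                       ≡⟨ cong Tr distribute ⟩
    Tr ((A * y ^ 3 + (A * P + A * Q)) + A * d ^ 3)             ≡⟨ Tr-homo-+ _ _ ⟩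
    Tr (A * y ^ 3 + (A * P + A * Q)) + h d                     ≡⟨ cong (_+ h d) (Tr-homo-+ _ _) ⟩
    (h y + Tr (A * P + A * Q)) + h d                           ≡⟨ cong (λ t → (h y + t) + h d) (trans (Tr-homo-+ _ _) (polar y d)) ⟩
    (h y + Tr (y * D d)) + h d                                 ∎
    where
    P = (y * y) * d
    Q = y * (d * d)
    distribute : A * ((y ^ 3 + (P + Q)) + d ^ 3) ≡ (A * y ^ 3 + (A * P + A * Q)) + A * d ^ 3
    distribute = trans (distribˡ A _ _) (cong (_+ A * d ^ 3) (trans (distribˡ A _ _) (cong (A * y ^ 3 +_) (distribˡ A P Q))))

  D-b≡0 : D b ≡ 0#
  D-b≡0 = begin
    √ (A * b) + A * (b * b)   ≡⟨ cong₂ (λ s t → √ s + t) Ab≡aa Abb≡a ⟩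
    √ (a * a) + a             ≡⟨ cong (_+ a) (√[x*x]≡x a) ⟩
    a + a                     ≡⟨ x+x≡0 a ⟩
    0#                        ∎
    where
    Ab≡aa : A * b ≡ a * a
    Ab≡aa = begin
      a ^ 3 * b                 ≡⟨ cong (_* b) (x^3≡x*x*x a) ⟩
      (a * (a * a)) * b         ≡⟨ *-solve 2 (λ a b → ((a · (a · a)) · b) ⊜* ((a · a) · (a · b))) refl a b ⟩
      (a * a) * (a * b)         ≡⟨ cong ((a * a) *_) ab≡1 ⟩
      (a * a) * 1#              ≡⟨ *-identityʳ _ ⟩
      a * a                     ∎
    Abb≡a : A * (b * b) ≡ a
    Abb≡a = begin
      A * (b * b)               ≡⟨ *-assoc A b b ⟨
      (A * b) * b               ≡⟨ cong (_* b) Ab≡aa ⟩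
      (a * a) * b               ≡⟨ *-assoc a a b ⟩
      a * (a * b)               ≡⟨ cong (a *_) ab≡1 ⟩
      a * 1#                    ≡⟨ *-identityʳ a ⟩
      a                         ∎

  h-b≡1 : h b ≡ 1#
  h-b≡1 = begin
    Tr (a ^ 3 * b ^ 3)   ≡⟨ cong Tr (^-distrib-* a b 3) ⟨
    Tr ((a * b) ^ 3)     ≡⟨ cong (λ t → Tr (t ^ 3)) ab≡1 ⟩
    Tr (1# ^ 3)          ≡⟨ cong Tr (^-zeroˡ 3) ⟩
    Tr 1#                ≡⟨ Tr-1 ⟩
    1#                   ∎

  h-+b : ∀ y → h (y + b) ≡ h y + 1#
  h-+b y = begin
    h (y + b)                     ≡⟨ h-+ y b ⟩
    (h y + Tr (y * D b)) + h b    ≡⟨ cong₂ (λ s t → (h y + Tr s) + t) (trans (cong (y *_) D-b≡0) (zeroʳ y)) h-b≡1 ⟩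
    (h y + Tr 0#) + 1#            ≡⟨ cong (λ t → (h y + t) + 1#) Tr-0 ⟩
    (h y + 0#) + 1#               ≡⟨ cong (_+ 1#) (+-identityʳ (h y)) ⟩
    h y + 1#                      ∎

  -- D d ≡ 0 forces (a d)³ ≡ 1, and cubing is injective on F since 3 ∤ 2 ^ (2k+1) - 1.
  D≡0⇒≡b : ∀ {d} → d ≢ 0# → D d ≡ 0# → d ≡ b
  D≡0⇒≡b {d} d≢0 Dd≡0 = begin
    d              ≡⟨ *-identityˡ d ⟨
    1# * d         ≡⟨ cong (_* d) (⁻¹-inverseˡ a a≢0) ⟨
    (b * a) * d    ≡⟨ *-assoc b a d ⟩
    b * (a * d)    ≡⟨ cong (b *_) (x^3≡1⇒x≡1 [ad]³≡1) ⟩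
    b * 1#         ≡⟨ *-identityʳ b ⟩
    b              ∎
    where
    √Ad≡Ad² : √ (A * d) ≡ A * (d * d)
    √Ad≡Ad² = x+y≡0⇒x≡y Dd≡0
    Ad³≡1 : A * (d * (d * d)) ≡ 1#
    Ad³≡1 = sym (*-cancelˡ (A * d) (*-≢0 A≢0 d≢0) (begin
      (A * d) * 1#                      ≡⟨ *-identityʳ _ ⟩
      A * d                             ≡⟨ √x*√x≡x (A * d) ⟨
      √ (A * d) * √ (A * d)             ≡⟨ cong₂ _*_ √Ad≡Ad² √Ad≡Ad² ⟩
      (A * (d * d)) * (A * (d * d))
        ≡⟨ *-solve 2 (λ A d → ((A · (d · d)) · (A · (d · d))) ⊜* ((A · d) · (A · (d · (d · d))))) refl A d ⟩
      (A * d) * (A * (d * (d * d)))     ∎))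
    [ad]³≡1 : (a * d) ^ 3 ≡ 1#
    [ad]³≡1 = trans (^-distrib-* a d 3) (trans (cong (A *_) (x^3≡x*x*x d)) Ad³≡1)

  Tr[·Dd]-surjective : ∀ {d} → d ≢ 0# → d ≢ b → ∃ λ w → Tr (w * D d) ≡ 1#
  Tr[·Dd]-surjective {d} d≢0 d≢b with D d ≟ 0#
  ... | yes Dd≡0 = ⊥-elim (d≢b (D≡0⇒≡b d≢0 Dd≡0))
  ... | no  Dd≢0 = D d ⁻¹ , trans (cong Tr (⁻¹-inverseˡ (D d) Dd≢0)) Tr-1

  b≢0 : b ≢ 0#
  b≢0 = ⁻¹-≢0 a≢0

  h-bit : ∀ y → IsBit (h y)
  h-bit y = Tr-bit (A * y ^ 3)

  h≡0⇒h[+b]≡1 : ∀ {y} → h y ≡ 0# → h (y + b) ≡ 1#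
  h≡0⇒h[+b]≡1 {y} hy≡0 = trans (h-+b y) (trans (cong (_+ 1#) hy≡0) (+-identityˡ 1#))

  h≡1⇒h[+b]≡0 : ∀ {y} → h y ≡ 1# → h (y + b) ≡ 0#
  h≡1⇒h[+b]≡0 {y} hy≡1 = trans (h-+b y) (trans (cong (_+ 1#) hy≡1) 1+1≡0)

  h≡0⇒h[+b]≢0 : ∀ {y} → h y ≡ 0# → h (y + b) ≢ 0#
  h≡0⇒h[+b]≢0 hy≡0 h[y+b]≡0 = 1≢0 (trans (sym (h≡0⇒h[+b]≡1 hy≡0)) h[y+b]≡0)

  φ : Carrier → Carrier
  φ u = u + b * h u

  φ-cases : ∀ u → (h u ≡ 0# × φ u ≡ u) ⊎ (h u ≡ 1# × φ u ≡ u + b)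
  φ-cases u with h-bit u
  ... | inj₁ hu≡0 = inj₁ (hu≡0 , trans (cong (λ t → u + b * t) hu≡0) (trans (cong (u +_) (zeroʳ b)) (+-identityʳ u)))
  ... | inj₂ hu≡1 = inj₂ (hu≡1 , trans (cong (λ t → u + b * t) hu≡1) (cong (u +_) (*-identityʳ b)))

  h∘φ≡0 : ∀ u → h (φ u) ≡ 0#
  h∘φ≡0 u with φ-cases u
  ... | inj₁ (hu≡0 , φu≡u)   = trans (cong h φu≡u) hu≡0
  ... | inj₂ (hu≡1 , φu≡u+b) = trans (cong h φu≡u+b) (h≡1⇒h[+b]≡0 hu≡1)

  φ-fixes : ∀ {y} → h y ≡ 0# → φ y ≡ y
  φ-fixes {y} hy≡0 with φ-cases y
  ... | inj₁ (_ , φy≡y)    = φy≡y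
  ... | inj₂ (hy≡1 , _)    = ⊥-elim (1≢0 (trans (sym hy≡1) hy≡0))

  φ-+b : ∀ u → φ (u + b) ≡ φ u
  φ-+b u = begin
    (u + b) + b * h (u + b)       ≡⟨ cong (λ t → (u + b) + b * t) (h-+b u) ⟩
    (u + b) + b * (h u + 1#)      ≡⟨ cong ((u + b) +_) (trans (distribˡ b (h u) 1#) (cong (b * h u +_) (*-identityʳ b))) ⟩
    (u + b) + (b * h u + b)
      ≡⟨ solve 3 (λ u b t → ((u ⊕ b) ⊕ (t ⊕ b)) ⊜ ((u ⊕ t) ⊕ (b ⊕ b))) refl u b (b * h u) ⟩
    (u + b * h u) + (b + b)       ≡⟨ cong ((u + b * h u) +_) (x+x≡0 b) ⟩
    (u + b * h u) + 0#            ≡⟨ +-identityʳ _ ⟩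
    φ u                           ∎

  φ-fibre : ∀ {u v} → φ u ≡ φ v → v ≡ u ⊎ v ≡ u + b
  φ-fibre {u} {v} φu≡φv = cases (Sum.map proj₂ proj₂ (φ-cases u)) (Sum.map proj₂ proj₂ (φ-cases v))
    where
    _≈_ : ∀ {s t} → φ u ≡ s → φ v ≡ t → s ≡ t
    φu≡s ≈ φv≡t = trans (sym φu≡s) (trans φu≡φv φv≡t)
    cases : φ u ≡ u ⊎ φ u ≡ u + b → φ v ≡ v ⊎ φ v ≡ v + b → v ≡ u ⊎ v ≡ u + b
    cases (inj₁ φu≡u)   (inj₁ φv≡v)   = inj₁ (sym (φu≡u ≈ φv≡v))
    cases (inj₂ φu≡u+b) (inj₂ φv≡v+b) = inj₁ (sym (+-cancelʳ b u v (φu≡u+b ≈ φv≡v+b)))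
    cases (inj₁ φu≡u)   (inj₂ φv≡v+b) = inj₂ (trans (sym (x+c+c≡x v b)) (cong (_+ b) (sym (φu≡u ≈ φv≡v+b))))
    cases (inj₂ φu≡u+b) (inj₁ φv≡v)   = inj₂ (sym (φu≡u+b ≈ φv≡v))

  preimages-φ : ∀ {y} → (∃ λ u → φ u ≡ y) → preimages φ y ≡ 2
  preimages-φ {y} (u , φu≡y) = count-pair (λ x → φ x ≟ y) (x≢x+c u b≢0) fibre φu≡y (trans (φ-+b u) φu≡y)
    where
    fibre : ∀ {x} → φ x ≡ y → x ≡ u ⊎ x ≡ u + b
    fibre φx≡y = φ-fibre (trans φu≡y (sym φx≡y))

  count-h≡0 : count (λ y → h y ≟ 0#) ≡ 2 ℕ.^ (2 ℕ.* k)
  count-h≡0 = c+c≡2^[1+j]⇒c≡2^j (2 ℕ.* k) (begin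
    count (λ y → h y ≟ 0#) ℕ.+ count (λ y → h y ≟ 0#)
      ≡⟨ count-halves (λ y → h y ≟ 0#) (_+ b) (λ y → x+c+c≡x y b) h≡0⇒h[+b]≢0 h≢0⇒h[+b]≡0 ⟩
    length elements                ≡⟨ #F≡2^[1+2k] ⟩
    2 ℕ.^ suc (2 ℕ.* k)            ∎)
    where
    h≢0⇒h[+b]≡0 : ∀ {y} → h y ≢ 0# → h (y + b) ≡ 0#
    h≢0⇒h[+b]≡0 {y} hy≢0 = h≡1⇒h[+b]≡0 (IsBit-≢0⇒≡1 (h-bit y) hy≢0)

  both-zero? : ∀ d → Decidable (λ r → h r ≡ 0# × h (r + d) ≡ 0#)
  both-zero? d r = (h r ≟ 0#) ×-dec (h (r + d) ≟ 0#)

  count-both-zero-b : count (both-zero? b) ≡ 0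
  count-both-zero-b = count-none (both-zero? b) λ r (hr≡0 , h[r+b]≡0) → h≡0⇒h[+b]≢0 hr≡0 h[r+b]≡0

  module _ {d} (d≢0 : d ≢ 0#) (d≢b : d ≢ b) where

    private
      w : Carrier
      w = proj₁ (Tr[·Dd]-surjective d≢0 d≢b)

      Tr[wDd]≡1 : Tr (w * D d) ≡ 1#
      Tr[wDd]≡1 = proj₂ (Tr[·Dd]-surjective d≢0 d≢b)

      Δ : Carrier → Carrier
      Δ r = h r + h (r + d)

      Δ≡Tr[·Dd]+hd : ∀ r → Δ r ≡ Tr (r * D d) + h d
      Δ≡Tr[·Dd]+hd r = begin
        h r + h (r + d)                     ≡⟨ cong (h r +_) (h-+ r d) ⟩
        h r + ((h r + Tr (r * D d)) + h d)
          ≡⟨ solve 3 (λ x y z → (x ⊕ ((x ⊕ y) ⊕ z)) ⊜ ((x ⊕ x) ⊕ (y ⊕ z))) refl (h r) _ (h d) ⟩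
        (h r + h r) + (Tr (r * D d) + h d)  ≡⟨ cong (_+ (Tr (r * D d) + h d)) (x+x≡0 (h r)) ⟩
        0# + (Tr (r * D d) + h d)           ≡⟨ +-identityˡ _ ⟩
        Tr (r * D d) + h d                  ∎

      Δ-+w : ∀ r → Δ (r + w) ≡ Δ r + 1#
      Δ-+w r = begin
        Δ (r + w)                                   ≡⟨ Δ≡Tr[·Dd]+hd (r + w) ⟩
        Tr ((r + w) * D d) + h d                    ≡⟨ cong (λ t → Tr t + h d) (distribʳ (D d) r w) ⟩
        Tr (r * D d + w * D d) + h d                ≡⟨ cong (_+ h d) (trans (Tr-homo-+ _ _) (cong (Tr (r * D d) +_) Tr[wDd]≡1)) ⟩
        (Tr (r * D d) + 1#) + h d
          ≡⟨ solve 3 (λ x y z → ((x ⊕ y) ⊕ z) ⊜ ((x ⊕ z) ⊕ y)) refl _ 1# (h d) ⟩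
        (Tr (r * D d) + h d) + 1#                   ≡⟨ cong (_+ 1#) (Δ≡Tr[·Dd]+hd r) ⟨
        Δ r + 1#                                    ∎

      agree? : Decidable (λ r → h r ≡ h (r + d))
      agree? r = h r ≟ h (r + d)

      both-one? : Decidable (λ r → h r ≡ 1# × h (r + d) ≡ 1#)
      both-one? r = (h r ≟ 1#) ×-dec (h (r + d) ≟ 1#)

      agree⇒Δ≡0 : ∀ {r} → h r ≡ h (r + d) → Δ r ≡ 0#
      agree⇒Δ≡0 {r} hr≡h[r+d] = trans (cong (h r +_) (sym hr≡h[r+d])) (x+x≡0 (h r))

      count-agree : count agree? ℕ.+ count agree? ≡ 2 ℕ.^ suc (2 ℕ.* k)
      count-agree = begin
        count agree? ℕ.+ count agree?  ≡⟨ count-halves agree? (_+ w) (λ r → x+c+c≡x r w) disagree agree ⟩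
        length elements                ≡⟨ #F≡2^[1+2k] ⟩
        2 ℕ.^ suc (2 ℕ.* k)            ∎
        where
        disagree : ∀ {r} → h r ≡ h (r + d) → h (r + w) ≢ h ((r + w) + d)
        disagree {r} hr≡h[r+d] h[r+w]≡h[r+w+d] = 1≢0 (begin
          1#            ≡⟨ +-identityˡ 1# ⟨
          0# + 1#       ≡⟨ cong (_+ 1#) (agree⇒Δ≡0 hr≡h[r+d]) ⟨
          Δ r + 1#      ≡⟨ Δ-+w r ⟨
          Δ (r + w)     ≡⟨ agree⇒Δ≡0 h[r+w]≡h[r+w+d] ⟩
          0#            ∎)
        agree : ∀ {r} → h r ≢ h (r + d) → h (r + w) ≡ h ((r + w) + d)
        agree {r} hr≢h[r+d] = x+y≡0⇒x≡y (begin
          Δ (r + w)     ≡⟨ Δ-+w r ⟩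
          Δ r + 1#      ≡⟨ cong (_+ 1#) Δr≡1 ⟩
          1# + 1#       ≡⟨ 1+1≡0 ⟩
          0#            ∎)
          where
          Δr≡1 : Δ r ≡ 1#
          Δr≡1 = IsBit-≢0⇒≡1 (IsBit-+ (h-bit r) (h-bit (r + d))) (hr≢h[r+d] ∘ x+y≡0⇒x≡y)

      count-agree≡ : count agree? ≡ count (both-zero? d) ℕ.+ count both-one?
      count-agree≡ = trans (count-cong agree? (both-zero? d ∪? both-one?) split join)
                           (count-⊎ (both-zero? d) both-one? λ (hr≡0 , _) (hr≡1 , _) → 1≢0 (trans (sym hr≡1) hr≡0))
        where
        split : ∀ {r} → h r ≡ h (r + d) → (h r ≡ 0# × h (r + d) ≡ 0#) ⊎ (h r ≡ 1# × h (r + d) ≡ 1#)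
        split {r} hr≡h[r+d] with h-bit r
        ... | inj₁ hr≡0 = inj₁ (hr≡0 , trans (sym hr≡h[r+d]) hr≡0)
        ... | inj₂ hr≡1 = inj₂ (hr≡1 , trans (sym hr≡h[r+d]) hr≡1)
        join : ∀ {r} → (h r ≡ 0# × h (r + d) ≡ 0#) ⊎ (h r ≡ 1# × h (r + d) ≡ 1#) → h r ≡ h (r + d)
        join (inj₁ (hr≡0 , h[r+d]≡0)) = trans hr≡0 (sym h[r+d]≡0)
        join (inj₂ (hr≡1 , h[r+d]≡1)) = trans hr≡1 (sym h[r+d]≡1)

      count-both-one≡count-both-zero : count both-one? ≡ count (both-zero? d)
      count-both-one≡count-both-zero =
        count-involution (both-zero? d) both-one? (_+ b) (λ r → x+c+c≡x r b) zeros⇒ones ones⇒zeros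
        where
        r+d+b≡r+b+d : ∀ r → (r + d) + b ≡ (r + b) + d
        r+d+b≡r+b+d r = solve 3 (λ r d b → ((r ⊕ d) ⊕ b) ⊜ ((r ⊕ b) ⊕ d)) refl r d b
        zeros⇒ones : ∀ {r} → h r ≡ 0# × h (r + d) ≡ 0# → h (r + b) ≡ 1# × h ((r + b) + d) ≡ 1#
        zeros⇒ones {r} (hr≡0 , h[r+d]≡0) =
          h≡0⇒h[+b]≡1 hr≡0 , subst (λ t → h t ≡ 1#) (r+d+b≡r+b+d r) (h≡0⇒h[+b]≡1 h[r+d]≡0)
        ones⇒zeros : ∀ {r} → h r ≡ 1# × h (r + d) ≡ 1# → h (r + b) ≡ 0# × h ((r + b) + d) ≡ 0#
        ones⇒zeros {r} (hr≡1 , h[r+d]≡1) =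
          h≡1⇒h[+b]≡0 hr≡1 , subst (λ t → h t ≡ 0#) (r+d+b≡r+b+d r) (h≡1⇒h[+b]≡0 h[r+d]≡1)

    count-both-zero : count (both-zero? d) ℕ.+ count (both-zero? d) ≡ 2 ℕ.^ (2 ℕ.* k)
    count-both-zero = begin
      count (both-zero? d) ℕ.+ count (both-zero? d)
        ≡⟨ cong (count (both-zero? d) ℕ.+_) count-both-one≡count-both-zero ⟨
      count (both-zero? d) ℕ.+ count both-one?        ≡⟨ count-agree≡ ⟨
      count agree?                                    ≡⟨ c+c≡2^[1+j]⇒c≡2^j (2 ℕ.* k) count-agree ⟩
      2 ℕ.^ (2 ℕ.* k)                                 ∎

  module _ {g : Carrier → Carrier} (g-permutation : IsPermutation g) where

    image⇒h≡0 : ∀ {y} → (∃ λ x → φ (g x) ≡ y) → h y ≡ 0#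
    image⇒h≡0 (x , refl) = h∘φ≡0 (g x)

    h≡0⇒image : ∀ {y} → h y ≡ 0# → ∃ λ x → φ (g x) ≡ y
    h≡0⇒image {y} hy≡0 with proj₂ g-permutation y
    ... | x , refl = x , φ-fixes hy≡0

    φ∘g-twoToOne : IsTwoToOne (φ ∘ g)
    φ∘g-twoToOne y (x , φgx≡y) =
      trans (preimages-∘-permutation g-permutation φ y) (preimages-φ (g x , φgx≡y))

    count-image : countF (image? (φ ∘ g)) ≡ 2 ℕ.^ (2 ℕ.* k)
    count-image = trans (count-cong (image? (φ ∘ g)) (λ y → h y ≟ 0#) image⇒h≡0 h≡0⇒image) count-h≡0

    diffCount-image : ∀ {d} → d ≢ 0# → diffCount (image? (φ ∘ g)) d ≡ count (both-zero? d)
    diffCount-image {d} d≢0 = trans (diffCount≡count (image? (φ ∘ g)) d≢0)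
      (count-cong _ (both-zero? d) (Product.map image⇒h≡0 image⇒h≡0) (Product.map h≡0⇒image h≡0⇒image))

mainTheorem2 : (k : ℕ) → k ≥ 1 → (F : FiniteField2^ (2 ℕ.* k ℕ.+ 1)) →
    let open FiniteField2^ F in
    (a : Carrier) → ¬ (a ≡ 0#) → (g : Carrier → Carrier) → IsPermutation g →
    let f = λ x → g x + (a ⁻¹) * Tr ((a ^ 3) * (g x ^ 3)) in
    IsTwoToOne f
    × IsRelDiffSet (2 ℕ.^ (2 ℕ.* k)) 2 (2 ℕ.^ (2 ℕ.* k)) (2 ℕ.^ (2 ℕ.* k ℕ.∸ 1))
        (λ y → (y ≟ 0#) ⊎-dec (y ≟ (a ⁻¹)))
        (image? f)
-- The statement's f unfolds to φ ∘ g.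
mainTheorem2 (suc k) (ℕ.s≤s ℕ.z≤n) F a a≢0 g g-permutation =
    φ∘g-twoToOne g-permutation
  , 2^[2k+1]≡2^[2k]*2 (suc k)
  , 0-or-c-isAddSubgroup b
  , count-0-or-c b≢0
  , count-image g-permutation
  , outside
  , inside
  where
  open FiniteField2^ F
  open FiniteFieldProperties F
  open CubicTrace (suc k) F a a≢0
  outside : ∀ d → ¬ (d ≡ 0# ⊎ d ≡ b) → diffCount (image? (φ ∘ g)) d ≡ 2 ℕ.^ (2 ℕ.* suc k ℕ.∸ 1)
  -- 2 ℕ.* suc k reduces to suc (2 ℕ.* suc k ℕ.∸ 1).
  outside d d∉N = trans (diffCount-image g-permutation (d∉N ∘ inj₁))
    (c+c≡2^[1+j]⇒c≡2^j (2 ℕ.* suc k ℕ.∸ 1) (count-both-zero (d∉N ∘ inj₁) (d∉N ∘ inj₂)))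
  inside : ∀ d → d ≡ 0# ⊎ d ≡ b → d ≢ 0# → diffCount (image? (φ ∘ g)) d ≡ 0
  inside d (inj₁ d≡0) d≢0 = ⊥-elim (d≢0 d≡0)
  inside d (inj₂ refl) d≢0 = trans (diffCount-image g-permutation d≢0) count-both-zero-b
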